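{- Let $G$ be a finite abelian group and $H$ a subgroup of index $2$. Then either $r(H)=r(G)$ or $r(H)=r(G\setminus H)$.
   Context: For $X\subset G$, $r(X)$ is the number of $x\in X$ with $x=-x$. -}

module Defs where

open import Level using (Level; _⊔_)
open import Data.Nat using (ℕ)
open import Data.List using (List; length; filter)
open import Data.List.Relation.Unary.Any using (Any)
open import Data.List.Relation.Unary.AllPairs using (AllPairs)
open import Data.Product using (_×_)
open import Relation.Nullary using (¬_; Dec; yes)
open import Relation.Nullary.Decidable using (_×-dec_; ¬?)
open import Relation.Unary using (Pred; Decidable; _∈_; _∉_)
open import Algebra.Bundles using (AbelianGroup)

module _ {c ℓ : Level} (G : AbelianGroup c ℓ) where
  open AbelianGroup G

  -- Finiteness of G: an explicit complete listing of its elements which is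
  -- duplicate-free up to the group's equality ≈, plus decidable equality.
  record FiniteEnum : Set (c ⊔ ℓ) where
    field
      elems    : List Carrier
      complete : ∀ x → Any (x ≈_) elems
      distinct : AllPairs (λ a b → ¬ (a ≈ b)) elems
      _≟_      : ∀ x y → Dec (x ≈ y)

  record IsSubgroup {p : Level} (H : Pred Carrier p) : Set (c ⊔ ℓ ⊔ p) where
    field
      resp    : ∀ {x y} → x ≈ y → x ∈ H → y ∈ H
      ε-mem   : ε ∈ H
      ∙-mem   : ∀ {x y} → x ∈ H → y ∈ H → (x ∙ y) ∈ H
      inv-mem : ∀ {x} → x ∈ H → (x ⁻¹) ∈ H

  module _ (F : FiniteEnum) where
    open FiniteEnum F

    order : ℕ
    order = length elems

    card : {p : Level} {X : Pred Carrier p} → Decidable X → ℕ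
    card X? = length (filter X? elems)

    -- r(X) = #{ x ∈ X | x = -x }  (here -x is written x ⁻¹)
    r : {p : Level} {X : Pred Carrier p} → Decidable X → ℕ
    r X? = length (filter (λ x → X? x ×-dec (x ≟ (x ⁻¹))) elems)

    compl? : {p : Level} {X : Pred Carrier p} → Decidable X → Decidable (λ x → x ∉ X)
    compl? X? x = ¬? (X? x)

    all? : Decidable {A = Carrier} (λ _ → Carrier)
    all? x = yes x

-- If no self-inverse element lies outside H, the self-inverse elements
-- of H and of G coincide, so r(H) = r(G).  Otherwise fix a self-inverse t ∉ H.
-- Left translation x ↦ t ∙ x is injective and, G being abelian, preserves
-- self-inverseness.  It maps H into G \ H (as t ∉ H) and, because H has index
-- 2, maps G \ H into H (two elements outside H have their product in H).
-- Injections in both directions give r(H) = r(G \ H).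
module Submission where

open import Defs
open import Level using (Level)
open import Data.Nat using (_*_)
open import Data.Sum using (_⊎_)
open import Relation.Binary.PropositionalEquality using (_≡_)
open import Relation.Unary using (Pred; Decidable)
open import Algebra.Bundles using (AbelianGroup)

open import Data.Nat using (suc; _+_; z≤n; s≤s; _≤_; _<_; >-nonZero)
open import Data.Nat.Properties using (≤-antisym; *-cancelʳ-≤; module ≤-Reasoning)
open import Data.Sum using (inj₁; inj₂; [_,_]′)
open import Data.Product using (_×_; _,_; proj₂; ∃)
open import Data.Empty using (⊥-elim)
open import Data.List using (List; []; _∷_; length; filter; map; concat)
open import Data.List.Properties using (length-map; length-++; length-removeAt′)
open import Data.List.Relation.Unary.Any using (here; there; index; any?; satisfied)
open import Data.List.Relation.Unary.All as All using (All; []; _∷_)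
import Data.List.Relation.Unary.All.Properties as All
open import Data.List.Relation.Unary.AllPairs as AllPairs using (AllPairs; []; _∷_)
import Data.List.Relation.Unary.AllPairs.Properties as AllPairs
import Data.List.Membership.Setoid as Membership
open import Data.List.Membership.Setoid.Properties using (∈-map⁻; ∈-filter⁺; ∈-filter⁻; ∈-length)
import Data.List.Relation.Unary.Unique.Setoid as UniqueSetoid
import Data.List.Relation.Unary.Unique.Setoid.Properties as Unique
open import Data.List.Relation.Binary.Disjoint.Setoid using (Disjoint)
open import Relation.Binary.Bundles using (Setoid)
import Relation.Binary.PropositionalEquality as ≡
open import Relation.Nullary using (¬_; yes; no)
open import Relation.Nullary.Decidable using (_×-dec_)
import Algebra.Properties.AbelianGroup as AbelianGroupProperties
import Relation.Binary.Reasoning.Setoid as SetoidReasoning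

module Pigeonhole {a ℓ : Level} (S : Setoid a ℓ) where
  open Setoid S
  open Membership S using (_∈_; _─_)
  open UniqueSetoid S using (Unique)

  ∈-─ : ∀ {x y ys} (p : x ∈ ys) → y ∈ ys → x ≉ y → y ∈ ys ─ p
  ∈-─ (here x≈z) (here y≈z) x≉y = ⊥-elim (x≉y (trans x≈z (sym y≈z)))
  ∈-─ (here _)   (there y∈ys) _ = y∈ys
  ∈-─ (there _)  (here y≈z) _   = here y≈z
  ∈-─ (there p)  (there y∈ys) x≉y = there (∈-─ p y∈ys x≉y)

  unique⇒length≤ : ∀ {xs ys} → Unique xs → All (_∈ ys) xs → length xs ≤ length ys
  unique⇒length≤ [] [] = z≤n
  unique⇒length≤ {x ∷ xs} {ys} (x≉xs ∷ xs!) (x∈ys ∷ xs⊆ys) = begin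
    suc (length xs)          ≤⟨ s≤s (unique⇒length≤ xs! xs⊆ys─x) ⟩
    suc (length (ys ─ x∈ys)) ≡⟨ ≡.sym (length-removeAt′ ys (index x∈ys)) ⟩
    length ys                ∎
    where
    open ≤-Reasoning
    xs⊆ys─x : All (_∈ ys ─ x∈ys) xs
    xs⊆ys─x = All.zipWith (λ (x≉z , z∈ys) → ∈-─ x∈ys z∈ys x≉z) (x≉xs , xs⊆ys)

module _ {c ℓ : Level} (G : AbelianGroup c ℓ) where
  open AbelianGroup G
  open AbelianGroupProperties G
    using (ε⁻¹≈ε; ⁻¹-∙-comm; ∙-cancelˡ; \\-leftDividesʳ; //-rightDividesʳ; y≈x\\z)
  open Membership setoid using (_∈_; lose)
  open Pigeonhole setoid using (unique⇒length≤)

  SelfInverse : Pred Carrier ℓ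
  SelfInverse x = x ≈ x ⁻¹

  selfInverse-resp : ∀ {x y} → x ≈ y → SelfInverse x → SelfInverse y
  selfInverse-resp x≈y x≈x⁻¹ = trans (sym x≈y) (trans x≈x⁻¹ (⁻¹-cong x≈y))

  selfInverse-∙ : ∀ {x y} → SelfInverse x → SelfInverse y → SelfInverse (x ∙ y)
  selfInverse-∙ {x} {y} x≈x⁻¹ y≈y⁻¹ = trans (∙-cong x≈x⁻¹ y≈y⁻¹) (⁻¹-∙-comm x y)

  module Subgroup {p : Level} {H : Pred Carrier p} (H-sub : IsSubgroup G H) where
    open IsSubgroup H-sub

    ∉-resp : ∀ {x y} → x ≈ y → ¬ H x → ¬ H y
    ∉-resp x≈y x∉H y∈H = x∉H (resp (sym x≈y) y∈H)

    translate-∉ : ∀ {g a} → ¬ H g → H a → ¬ H (g ∙ a)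
    translate-∉ {g} {a} g∉H a∈H ga∈H =
      g∉H (resp (//-rightDividesʳ a g) (∙-mem ga∈H (inv-mem a∈H)))

    cosets-meet : ∀ {g h a b} → H a → H b → g ∙ a ≈ h ∙ b → H (g ⁻¹ ∙ h)
    cosets-meet {g} {h} {a} {b} a∈H b∈H ga≈hb =
      resp (y≈x\\z g (a ∙ b ⁻¹) h g[ab⁻¹]≈h) (∙-mem a∈H (inv-mem b∈H))
      where
      open SetoidReasoning setoid
      g[ab⁻¹]≈h : g ∙ (a ∙ b ⁻¹) ≈ h
      g[ab⁻¹]≈h = begin
        g ∙ (a ∙ b ⁻¹) ≈⟨ assoc g a (b ⁻¹) ⟨
        g ∙ a ∙ b ⁻¹   ≈⟨ ∙-congʳ ga≈hb ⟩
        h ∙ b ∙ b ⁻¹   ≈⟨ //-rightDividesʳ b h ⟩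
        h              ∎

  module Finite (F : FiniteEnum G) where
    open FiniteEnum F

    card-≤ : ∀ {p q} {P : Pred Carrier p} {Q : Pred Carrier q}
             (P? : Decidable P) (Q? : Decidable Q) → (∀ {x y} → x ≈ y → Q x → Q y) →
             (f : Carrier → Carrier) → (∀ {x y} → f x ≈ f y → x ≈ y) →
             (∀ {x} → P x → Q (f x)) → card G F P? ≤ card G F Q?
    card-≤ P? Q? Q-resp f f-injective P⇒Qf = begin
      card G F P?                       ≡⟨ ≡.sym (length-map f (filter P? elems)) ⟩
      length (map f (filter P? elems))  ≤⟨ unique⇒length≤ image-unique image⊆Q ⟩
      card G F Q?                       ∎
      where
      open ≤-Reasoning
      image-unique : UniqueSetoid.Unique setoid (map f (filter P? elems))
      image-unique = Unique.map⁺ setoid setoid f-injective (Unique.filter⁺ setoid P? distinct)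
      image⊆Q : All (_∈ filter Q? elems) (map f (filter P? elems))
      image⊆Q = All.map⁺ (All.map
        (λ {x} Px → ∈-filter⁺ setoid Q? Q-resp (complete (f x)) (P⇒Qf Px))
        (All.all-filter P? elems))

    card-≡ : ∀ {p q} {P : Pred Carrier p} {Q : Pred Carrier q}
             (P? : Decidable P) (Q? : Decidable Q) →
             (∀ {x y} → x ≈ y → P x → P y) → (∀ {x y} → x ≈ y → Q x → Q y) →
             (f : Carrier → Carrier) → (∀ {x y} → f x ≈ f y → x ≈ y) →
             (∀ {x} → P x → Q (f x)) → (∀ {x} → Q x → P (f x)) →
             card G F P? ≡ card G F Q?
    card-≡ P? Q? P-resp Q-resp f f-injective P⇒Qf Q⇒Pf =
      ≤-antisym (card-≤ P? Q? Q-resp f f-injective P⇒Qf)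
                (card-≤ Q? P? P-resp f f-injective Q⇒Pf)

    -- The decision procedure for "x ∈ X and x is self-inverse" used by r, so
    -- that r X? is definitionally card (selfInverse? X?).
    selfInverse? : ∀ {p} {X : Pred Carrier p} → Decidable X → Decidable (λ x → X x × SelfInverse x)
    selfInverse? X? x = X? x ×-dec (x ≟ (x ⁻¹))

    module Index {p : Level} {H : Pred Carrier p} (H? : Decidable H) (H-sub : IsSubgroup G H) where
      open IsSubgroup H-sub
      open Subgroup H-sub

      coset : Carrier → List Carrier
      coset g = map (g ∙_) (filter H? elems)

      coset-unique : ∀ g → UniqueSetoid.Unique setoid (coset g)
      coset-unique g =
        Unique.map⁺ setoid setoid (∙-cancelˡ g _ _) (Unique.filter⁺ setoid H? distinct)

      cosets-disjoint : ∀ {g h} → ¬ H (g ⁻¹ ∙ h) → Disjoint setoid (coset g) (coset h)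
      cosets-disjoint g⁻¹h∉H (v∈gH , v∈hH)
        with ∈-map⁻ setoid setoid v∈gH | ∈-map⁻ setoid setoid v∈hH
      ... | a , a∈H , v≈ga | b , b∈H , v≈hb =
        g⁻¹h∉H (cosets-meet (member a∈H) (member b∈H) (trans (sym v≈ga) v≈hb))
        where
        member : ∀ {x} → x ∈ filter H? elems → H x
        member x∈H = proj₂ (∈-filter⁻ setoid H? resp {xs = elems} x∈H)

      length-cosets : ∀ gs → length (concat (map coset gs)) ≡ length gs * card G F H?
      length-cosets [] = ≡.refl
      length-cosets (g ∷ gs) = ≡.trans (length-++ (coset g))
        (≡.cong₂ _+_ (length-map (g ∙_) (filter H? elems)) (length-cosets gs))

      distinct-cosets-bound : ∀ gs → AllPairs (λ g h → ¬ H (g ⁻¹ ∙ h)) gs →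
                              length gs * card G F H? ≤ order G F
      distinct-cosets-bound gs distinct-cosets = begin
        length gs * card G F H?            ≡⟨ ≡.sym (length-cosets gs) ⟩
        length (concat (map coset gs))     ≤⟨ unique⇒length≤ union-unique union⊆G ⟩
        order G F                          ∎
        where
        open ≤-Reasoning
        union⊆G : All (_∈ elems) (concat (map coset gs))
        union⊆G = All.tabulate (λ {v} _ → complete v)
        union-unique : UniqueSetoid.Unique setoid (concat (map coset gs))
        union-unique = Unique.concat⁺ setoid (All.map⁺ (All.tabulate (λ {g} _ → coset-unique g)))
                         (AllPairs.map⁺ (AllPairs.map cosets-disjoint distinct-cosets))

      card-positive : 0 < card G F H?
      card-positive = ∈-length setoid (∈-filter⁺ setoid H? resp {xs = elems} (complete ε) ε-mem)

      -- In a subgroup of index 2 the product of two elements outside H lies in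
      -- H: otherwise H, xH and (x ∙ y)H would be three distinct cosets.
      index-two-product : 2 * card G F H? ≡ order G F →
                          ∀ {x y} → ¬ H x → ¬ H y → H (x ∙ y)
      index-two-product index-two {x} {y} x∉H y∉H with H? (x ∙ y)
      ... | yes xy∈H = xy∈H
      ... | no  xy∉H =
        ⊥-elim (3≰2 (*-cancelʳ-≤ 3 2 (card G F H?) {{>-nonZero card-positive}} three-cosets))
        where
        ε⁻¹∙-identity : ∀ z → z ≈ ε ⁻¹ ∙ z
        ε⁻¹∙-identity z = sym (trans (∙-congʳ ε⁻¹≈ε) (identityˡ z))
        -- εH, xH, (x ∙ y)H are distinct since x, x ∙ y and x⁻¹ ∙ (x ∙ y) ≈ y lie outside H.
        three-cosets : 3 * card G F H? ≤ 2 * card G F H?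
        three-cosets = ≡.subst (3 * card G F H? ≤_) (≡.sym index-two)
          (distinct-cosets-bound (ε ∷ x ∷ (x ∙ y) ∷ [])
            ((∉-resp (ε⁻¹∙-identity x) x∉H ∷ ∉-resp (ε⁻¹∙-identity (x ∙ y)) xy∉H ∷ [])
            ∷ (∉-resp (sym (\\-leftDividesʳ x y)) y∉H ∷ [])
            ∷ [] ∷ []))
        3≰2 : ¬ 3 ≤ 2
        3≰2 (s≤s (s≤s ()))

      H×SelfInverse-resp : ∀ {x y} → x ≈ y → H x × SelfInverse x → H y × SelfInverse y
      H×SelfInverse-resp x≈y (x∈H , sx) = resp x≈y x∈H , selfInverse-resp x≈y sx

      ∉H×SelfInverse-resp : ∀ {x y} → x ≈ y → ¬ H x × SelfInverse x → ¬ H y × SelfInverse y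
      ∉H×SelfInverse-resp x≈y (x∉H , sx) = ∉-resp x≈y x∉H , selfInverse-resp x≈y sx

      selfInverse-outside-or-inside : (∃ λ t → ¬ H t × SelfInverse t) ⊎ (∀ x → SelfInverse x → H x)
      selfInverse-outside-or-inside with any? (selfInverse? (compl? G F H?)) elems
      ... | yes some = inj₁ (satisfied some)
      ... | no  none = inj₂ inside
        where
        inside : ∀ x → SelfInverse x → H x
        inside x sx with H? x
        ... | yes x∈H = x∈H
        ... | no  x∉H = ⊥-elim (none (lose ∉H×SelfInverse-resp (complete x) (x∉H , sx)))

      r-inside : (∀ x → SelfInverse x → H x) → r G F H? ≡ r G F (all? G F)
      r-inside inside = card-≡ (selfInverse? H?) (selfInverse? (all? G F))
        H×SelfInverse-resp (λ {_} {y} x≈y (_ , sx) → y , selfInverse-resp x≈y sx)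
        (λ x → x) (λ x≈y → x≈y)
        (λ {x} (_ , sx) → x , sx) (λ {x} (_ , sx) → inside x sx , sx)

      -- Case 2: translation by a self-inverse t ∉ H exchanges the self-inverse
      -- elements of H and of G \ H, so r(H) = r(G \ H).
      r-translate : 2 * card G F H? ≡ order G F → ∀ {t} → ¬ H t → SelfInverse t →
                    r G F H? ≡ r G F (compl? G F H?)
      r-translate index-two {t} t∉H st = card-≡ (selfInverse? H?) (selfInverse? (compl? G F H?))
        H×SelfInverse-resp ∉H×SelfInverse-resp
        (t ∙_) (∙-cancelˡ t _ _)
        (λ (x∈H , sx) → translate-∉ t∉H x∈H , selfInverse-∙ st sx)
        (λ (x∉H , sx) → index-two-product index-two t∉H x∉H , selfInverse-∙ st sx)

fact2p4 : {c ℓ p : Level} (G : AbelianGroup c ℓ) (F : FiniteEnum G)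
          (H : Pred (AbelianGroup.Carrier G) p) (H? : Decidable H) →
          IsSubgroup G H →
          2 * card G F H? ≡ order G F →
          (r G F H? ≡ r G F (all? G F)) ⊎ (r G F H? ≡ r G F (compl? G F H?))
fact2p4 G F H H? H-sub index-two =
  [ (λ (t , t∉H , st) → inj₂ (r-translate index-two t∉H st))
  , (λ inside → inj₁ (r-inside inside))
  ]′ selfInverse-outside-or-inside
  where open Finite G F; open Index H? H-sub
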